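{- Let $G=(X,Y,E)$ be a chordal bipartite graph in which every vertex has degree at most $3$. Then: (i) $G^2$ is hole-free; (ii) if $G$ is $H_4$-free, then $G^2$ is $A_4$-free.
   Context: A hole is a chordless (induced) cycle with at least 5 vertices. A bipartite graph is chordal bipartite if it contains no induced cycle $C_{2k}$ with $k\ge 3$. The square $G^2$ of $G$ has the same vertex set, with distinct $x,y$ adjacent iff their distance in $G$ is at most 2. $A_4$ is the graph on vertices $v_1,\dots,v_5$ where $v_1v_2v_3v_4$ induce a 4-cycle $C_4$ and $v_5$ is adjacent only to $v_3$. $H_4$ (the extended domino) is the graph on 8 vertices $a_1,\dots,a_6,b,c$ whose edges are those of the 6-cycle $a_1a_2a_3a_4a_5a_6a_1$, the chord $a_2a_5$, and the edges $a_4b$ and $bc$ (i.e. a domino with a pendant path of length 2 attached at a degree-2 vertex). A graph is $H$-free if it has no induced subgraph isomorphic to $H$. -}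

module Defs where

open import Data.Nat using (ℕ; zero; suc; _≤_; _*_)
open import Data.Fin using (Fin; toℕ)
open import Data.Bool using (Bool)
import Data.Nat
import Data.Nat.Properties
open import Data.Product using (Σ; _×_; _,_)
open import Data.Sum using (_⊎_)
open import Data.List using (List; []; _∷_)
open import Data.List.Membership.Propositional using (_∈_)
open import Data.Empty using (⊥)
open import Relation.Nullary using (¬_; Dec)
open import Relation.Binary.PropositionalEquality using (_≡_; _≢_)
open import Function.Definitions using (Injective)
open import Level using (0ℓ)

record Graph : Set₁ where
  field
    n     : ℕ
    Adj   : Fin n → Fin n → Set
    sym   : ∀ {x y} → Adj x y → Adj y x
    irrefl : ∀ {x} → ¬ Adj x x
open Graph public

-- Adjacency is decidable (automatic classically for finite graphs).
DecidableGraph : Graph → Set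
DecidableGraph G = ∀ x y → Dec (Adj G x y)

InducedIn : Graph → Graph → Set
InducedIn H G = Σ (Fin (n H) → Fin (n G)) λ f →
  Injective _≡_ _≡_ f ×
  (∀ i j → (Adj G (f i) (f j) → Adj H i j) × (Adj H i j → Adj G (f i) (f j)))

_-free : Graph → Graph → Set
(H -free) G = ¬ InducedIn H G

square : Graph → Graph
square G = record
  { n = n G
  ; Adj = λ x y → x ≢ y × (Adj G x y ⊎ Σ (Fin (n G)) λ z → Adj G x z × Adj G z y)
  ; sym = λ { (x≢y , _⊎_.inj₁ a) → (λ e → x≢y (symm e)) , _⊎_.inj₁ (sym G a)
            ; (x≢y , _⊎_.inj₂ (z , a , b)) → (λ e → x≢y (symm e)) , _⊎_.inj₂ (z , sym G b , sym G a) }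
  ; irrefl = λ { (x≢x , _) → x≢x Relation.Binary.PropositionalEquality.refl }
  }
  where open Relation.Binary.PropositionalEquality renaming (sym to symm)

-- Bipartite: there is a 2-colouring (X = colour true, Y = colour false).
Bipartite : Graph → Set
Bipartite G = Σ (Fin (n G) → Bool) λ c → ∀ {x y} → Adj G x y → c x ≢ c y

MaxDegree≤3 : Graph → Set
MaxDegree≤3 G = ∀ (v : Fin (n G)) (f : Fin 4 → Fin (n G)) →
  Injective _≡_ _≡_ f → ¬ (∀ i → Adj G v (f i))

CycSucc : (m : ℕ) → Fin m → Fin m → Set
CycSucc m i j = suc (toℕ i) ≡ toℕ j ⊎ (suc (toℕ i) ≡ m × toℕ j ≡ 0)

cycle : (m : ℕ) → 3 ≤ m → Graph
cycle m 3≤m = record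
  { n = m
  ; Adj = λ i j → CycSucc m i j ⊎ CycSucc m j i
  ; sym = λ { (_⊎_.inj₁ a) → _⊎_.inj₂ a ; (_⊎_.inj₂ a) → _⊎_.inj₁ a }
  ; irrefl = irr
  }
  where
  open import Data.Nat.Properties using (1+n≢n)
  open Relation.Binary.PropositionalEquality using (trans; refl) renaming (sym to ≡sym)
  bad₀ : ∀ {k} → 1 ≡ k → 3 ≤ k → ⊥
  bad₀ refl (Data.Nat.s≤s ())
  bad : 1 ≡ m → ⊥
  bad e = bad₀ e 3≤m
  irr₀ : ∀ {i} → ¬ CycSucc m i i
  irr₀ (_⊎_.inj₁ e) = 1+n≢n e
  irr₀ {i} (_⊎_.inj₂ (e , z)) = bad (trans (Relation.Binary.PropositionalEquality.cong suc (≡sym z)) e)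
  irr : ∀ {i} → ¬ (CycSucc m i i ⊎ CycSucc m i i)
  irr (_⊎_.inj₁ a) = irr₀ a
  irr (_⊎_.inj₂ a) = irr₀ a

fromEdges : (k : ℕ) → List (ℕ × ℕ) → Graph
fromEdges k es = record
  { n = k
  ; Adj = λ i j → i ≢ j × ((toℕ i , toℕ j) ∈ es ⊎ (toℕ j , toℕ i) ∈ es)
  ; sym = λ { (d , _⊎_.inj₁ a) → (λ e → d (Relation.Binary.PropositionalEquality.sym e)) , _⊎_.inj₂ a
            ; (d , _⊎_.inj₂ a) → (λ e → d (Relation.Binary.PropositionalEquality.sym e)) , _⊎_.inj₁ a }
  ; irrefl = λ { (d , _) → d Relation.Binary.PropositionalEquality.refl }
  }

-- A₄ : v₁..v₅ = 0..4; C₄ = v₁v₂v₃v₄, v₅ adjacent only to v₃.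
A₄ : Graph
A₄ = fromEdges 5 ((0 , 1) ∷ (1 , 2) ∷ (2 , 3) ∷ (3 , 0) ∷ (4 , 2) ∷ [])

-- H₄ (extended domino): a₁..a₆ = 0..5, b = 6, c = 7;
-- 6-cycle a₁…a₆a₁, chord a₂a₅, edges a₄b, bc.
H₄ : Graph
H₄ = fromEdges 8 ((0 , 1) ∷ (1 , 2) ∷ (2 , 3) ∷ (3 , 4) ∷ (4 , 5) ∷ (5 , 0)
                 ∷ (1 , 4) ∷ (3 , 6) ∷ (6 , 7) ∷ [])

ChordalBipartite : Graph → Set
ChordalBipartite G = Bipartite G ×
  (∀ k (p : 3 ≤ k) → (cycle (2 * k) (lem k p) -free) G)
  where
  lem : ∀ k → 3 ≤ k → 3 ≤ 2 * k
  lem k p = Data.Nat.Properties.≤-trans p (Data.Nat.Properties.m≤n*m k 2)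

HoleFree : Graph → Set
HoleFree G = ∀ m (p : 5 ≤ m) → (cycle m (lem m p) -free) G
  where
  lem : ∀ m → 5 ≤ m → 3 ≤ m
  lem m p = Data.Nat.Properties.≤-trans (Data.Nat.s≤s (Data.Nat.s≤s (Data.Nat.s≤s Data.Nat.z≤n))) p

module Submission where

-- Let h₀ … h_{m-1} be a chordless cycle of G² (m ≥ 5 for a hole, m = 4 for the 4-cycle
-- of an A₄).  Consecutive vertices are adjacent in G or joined through a bridge vertex; inserting
-- the bridges gives the lift of h, a cycle of G (its vertices are distinct because h has no chord
-- in G²).  It has length ≥ 5, hence ≥ 6 since G is bipartite.  Splitting along chords reduces it
-- to a chordless even cycle of length ≥ 6, impossible in a chordal bipartite graph, or to a domino
-- (hexagon with a long chord) on lift vertices.  By the degree bound, the chord ends of this domino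
-- are bridges and its four other vertices are hole vertices, pairwise at G-distance ≤ 2 around a
-- square.  For m ≥ 5 that contradicts the chordlessness of h, giving (i); for m = 4 the pendant
-- vertex of A₄ extends the domino to an induced H₄ of G, giving (ii).

open import Data.Nat as ℕ using (ℕ; zero; suc; _+_; _∸_; _≤_; _<_; z≤n; s≤s)
open import Data.Nat.Properties
open import Data.Fin as F using (Fin; zero; suc; toℕ; fromℕ<)
open import Data.Fin.Properties using (toℕ-fromℕ<; toℕ-injective; toℕ<n; all?; ¬∀⟶∃¬; inject₁-injective) renaming (_≟_ to _≟ᶠ_; <-cmp to <ᶠ-cmp)
open import Data.Product as Prod using (Σ; _×_; _,_; proj₁; proj₂; uncurry)
open import Data.List as List using (List; []; _∷_; _++_; allFin; concat; applyUpTo; length)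
open import Data.List.Relation.Unary.All as All using (All; []; _∷_)
open import Data.List.Relation.Unary.AllPairs using ([]; _∷_)
open import Data.List.Relation.Unary.Any using (here; there)
open import Data.List.Relation.Unary.Unique.Propositional using (Unique)
open import Data.List.Membership.Propositional using (_∈_)
open import Data.List.Membership.Propositional.Properties using (∈-lookup; ∈-map⁺; ∈-allFin; ∈-++⁺ˡ; ∈-++⁺ʳ; ∈-concat⁻′; ∈-applyUpTo⁻)
open import Data.List.Properties using (length-++)
open import Data.List.Relation.Binary.Disjoint.Propositional using (Disjoint)
import Data.List.Relation.Unary.All.Properties as All
import Data.List.Relation.Unary.AllPairs.Properties as AllPairs
import Data.List.Relation.Unary.Unique.Propositional.Properties as Unique
open import Data.List.Membership.DecPropositional using () renaming (_∈?_ to member?)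
open import Data.Product.Properties using (≡-dec)
open import Function.Definitions using (Injective)
open import Data.Fin.Patterns using (0F; 1F; 2F; 3F; 4F; 5F)
import Data.Vec as Vec
open Vec using ([]; _∷_)
open import Data.Sum using (_⊎_; inj₁; inj₂)
import Data.Sum
open import Data.Empty using (⊥; ⊥-elim)
open import Data.Unit using (⊤; tt)
open import Data.Nat.Induction using (<-rec)
open import Relation.Binary.PropositionalEquality
open import Relation.Binary.Definitions using (tri<; tri≈; tri>)
open import Relation.Nullary using (Dec; yes; no; ¬_)
open import Relation.Nullary.Decidable using (¬?; _×-dec_; _⊎-dec_; _→-dec_; True; toWitness)
open import Data.Bool using (Bool; true; false; not)
open import Data.Bool.Properties using (not-involutive; ¬-not)
open import Defs renaming (sym to adj-sym)

next : ∀ {L} → Fin L → Fin L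
next {suc n} i with suc (toℕ i) ℕ.<? suc n
... | yes p = fromℕ< p
... | no _ = zero

next-cases : ∀ {L} (i : Fin L) →
  (suc (toℕ i) < L × toℕ (next i) ≡ suc (toℕ i)) ⊎ (suc (toℕ i) ≡ L × toℕ (next i) ≡ 0)
next-cases {suc n} i with suc (toℕ i) ℕ.<? suc n
... | yes p = inj₁ (p , toℕ-fromℕ< p)
... | no ¬p = inj₂ (≤-antisym (toℕ<n i) (≮⇒≥ ¬p) , refl)

CycSucc⇒next : ∀ {L} {i j : Fin L} → CycSucc L i j → next i ≡ j
CycSucc⇒next {i = i} {j} s with next-cases i | s
... | inj₁ (_ , e) | inj₁ q = toℕ-injective (trans e q)
... | inj₁ (p , _) | inj₂ (q , _) = ⊥-elim (<-irrefl q p)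
... | inj₂ (q , _) | inj₁ r = ⊥-elim (<-irrefl (trans (sym r) q) (toℕ<n j))
... | inj₂ (_ , e) | inj₂ (_ , r) = toℕ-injective (trans e (sym r))

next⇒CycSucc : ∀ {L} {i j : Fin L} → next i ≡ j → CycSucc L i j
next⇒CycSucc {i = i} refl with next-cases i
... | inj₁ (_ , e) = inj₁ (sym e)
... | inj₂ (q , e) = inj₂ (q , e)

Consecutive : ∀ {L} → Fin L → Fin L → Set
Consecutive i j = next i ≡ j ⊎ next j ≡ i

consecutive? : ∀ {L} (i j : Fin L) → Dec (Consecutive i j)
consecutive? i j = (next i ≟ᶠ j) ⊎-dec (next j ≟ᶠ i)

step : ∀ {L} → ℕ → Fin L → Fin L
step zero i = i
step (suc a) i = next (step a i)

step-+ : ∀ {L} a b (i : Fin L) → step (a + b) i ≡ step a (step b i)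
step-+ zero b i = refl
step-+ (suc a) b i = cong next (step-+ a b i)

step-toℕ : ∀ {L} a (i : Fin L) → toℕ i + a < L → toℕ (step a i) ≡ toℕ i + a
step-toℕ zero i _ = sym (+-identityʳ _)
step-toℕ (suc a) i p with step-toℕ a i (<-trans (+-monoʳ-< (toℕ i) (n<1+n a)) p) | next-cases (step a i)
... | ih | inj₁ (_ , e) = trans e (trans (cong suc ih) (sym (+-suc (toℕ i) a)))
... | ih | inj₂ (q , _) = ⊥-elim (<-irrefl (trans (+-suc (toℕ i) a) (trans (cong suc (sym ih)) q)) p)

step-from-0 : ∀ {L} a (w : Fin L) → toℕ w ≡ 0 → a < L → toℕ (step a w) ≡ a
step-from-0 a w w≡0 a<L = trans (step-toℕ a w (subst (λ x → x + a < _) (sym w≡0) a<L)) (cong (_+ a) w≡0)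

step-to-0 : ∀ {L} (i : Fin L) r → toℕ i + suc r ≡ L → toℕ (step (suc r) i) ≡ 0
step-to-0 {L} i r e with next-cases (step r i)
... | inj₂ (_ , z) = z
... | inj₁ (p , _) = ⊥-elim (<-irrefl (trans (cong suc (step-toℕ r i lt)) (trans (sym (+-suc (toℕ i) r)) e)) p)
  where
  lt : toℕ i + r < L
  lt = subst (_≤ L) (+-suc (toℕ i) r) (≤-reflexive e)

remaining : ∀ {L} (i : Fin L) → Σ ℕ λ r → toℕ i + suc r ≡ L
remaining {L} i = L ∸ suc (toℕ i) , trans (+-suc (toℕ i) _) (m+[n∸m]≡n (toℕ<n i))

step-past-end : ∀ {L} a (i : Fin L) r → toℕ i + suc r ≡ L → a < L → toℕ (step (a + suc r) i) ≡ a
step-past-end a i r e a<L = trans (cong toℕ (step-+ a (suc r) i)) (step-from-0 a _ (step-to-0 i r e) a<L)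

step-period : ∀ {L} (i : Fin L) → step L i ≡ i
step-period {L} i with remaining i
... | r , e = toℕ-injective (subst (λ x → toℕ (step x i) ≡ toℕ i) e (step-past-end (toℕ i) i r e (toℕ<n i)))

step-moves : ∀ {L} e (w : Fin L) → 0 < e → e < L → step e w ≢ w
step-moves {L} e w 0<e e<L eq with (toℕ w + e) ℕ.<? L
... | yes lt = <-irrefl (trans (sym (cong toℕ eq)) (step-toℕ e w lt)) (m<m+n (toℕ w) 0<e)
... | no ¬lt with remaining w
...   | r , er = <-irrefl (trans (sym (step-past-end s w r er s<L)) (trans (cong (λ x → toℕ (step x w)) (sym es)) (cong toℕ eq))) s<w
  where
  r<e : suc r ≤ e
  r<e = +-cancelˡ-≤ (toℕ w) _ _ (subst (_≤ toℕ w + e) (sym er) (≮⇒≥ ¬lt))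
  s : ℕ
  s = e ∸ suc r
  es : e ≡ s + suc r
  es = sym (m∸n+n≡m r<e)
  s<w : s < toℕ w
  s<w = +-cancelʳ-< (suc r) s (toℕ w) (subst₂ _<_ es (sym er) e<L)
  s<L : s < L
  s<L = <-trans s<w (toℕ<n w)

step-injective : ∀ {L} a b (u : Fin L) → a < L → b < L → step a u ≡ step b u → a ≡ b
step-injective a b u a<L b<L eq with <-cmp a b
... | tri≈ _ a≡b _ = a≡b
... | tri< a<b _ _ = ⊥-elim (step-moves (b ∸ a) (step a u) (m<n⇒0<n∸m a<b) (≤-<-trans (m∸n≤m b a) b<L)
        (trans (sym (step-+ (b ∸ a) a u)) (trans (cong (λ x → step x u) (m∸n+n≡m (<⇒≤ a<b))) (sym eq))))
... | tri> _ _ b<a = ⊥-elim (step-moves (a ∸ b) (step b u) (m<n⇒0<n∸m b<a) (≤-<-trans (m∸n≤m a b) a<L)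
        (trans (sym (step-+ (a ∸ b) b u)) (trans (cong (λ x → step x u) (m∸n+n≡m (<⇒≤ b<a))) eq)))

step-reaches : ∀ {L} (k l : Fin L) → Σ ℕ λ d → d < L × step d k ≡ l
step-reaches {L} k l with toℕ k ℕ.≤? toℕ l
... | yes k≤l = toℕ l ∸ toℕ k , ≤-<-trans (m∸n≤m (toℕ l) (toℕ k)) (toℕ<n l) ,
      toℕ-injective (trans (step-toℕ _ k (subst (_< L) (sym (m+[n∸m]≡n k≤l)) (toℕ<n l))) (m+[n∸m]≡n k≤l))
... | no k≰l with remaining k
...   | r , e = toℕ l + suc r , subst (toℕ l + suc r <_) e (+-monoˡ-< (suc r) (≰⇒> k≰l)) ,
      toℕ-injective (step-past-end (toℕ l) k r e (toℕ<n l))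

-- next is a permutation: L - 1 further steps undo it.
next-injective : ∀ {L} {i j : Fin L} → next i ≡ next j → i ≡ j
next-injective {L} {i} {j} e = trans (sym (back i)) (trans (cong (step (L ∸ 1)) e) (back j))
  where
  back : ∀ (x : Fin L) → step (L ∸ 1) (next x) ≡ x
  back x = trans (sym (step-+ (L ∸ 1) 1 x))
                 (trans (cong (λ y → step y x) (m∸n+n≡m (≤-trans (s≤s z≤n) (toℕ<n x)))) (step-period x))

flips : ℕ → Bool → Bool
flips zero b = b
flips (suc a) b = not (flips a b)

Even : ℕ → Set
Even a = flips a true ≡ true

flips-not : ∀ a b → flips a (not b) ≡ not (flips a b)
flips-not zero b = refl
flips-not (suc a) b = cong not (flips-not a b)

flips-fixed⇒even : ∀ a b → flips a b ≡ b → Even a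
flips-fixed⇒even a true e = e
flips-fixed⇒even a false e with flips a true in eq
... | true = refl
... | false = ⊥-elim (not-false (trans (trans (cong not (sym eq)) (sym (flips-not a true))) e))
  where
  not-false : not false ≢ false
  not-false ()

even-3-5 : ∀ a → 3 ≤ a → a < 6 → Even a → a ≡ 4
even-3-5 2 (s≤s (s≤s ())) _ _
even-3-5 3 _ _ ()
even-3-5 4 _ _ _ = refl
even-3-5 5 _ _ ()
even-3-5 (suc (suc (suc (suc (suc (suc a)))))) _ (s≤s (s≤s (s≤s (s≤s (s≤s (s≤s ())))))) _

even-≥5 : ∀ a → 5 ≤ a → Even a → 6 ≤ a
even-≥5 2 (s≤s (s≤s ())) _
even-≥5 4 (s≤s (s≤s (s≤s (s≤s ())))) _
even-≥5 5 _ ()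
even-≥5 (suc (suc (suc (suc (suc (suc a)))))) _ _ = s≤s (s≤s (s≤s (s≤s (s≤s (s≤s z≤n)))))

even⇒double : ∀ a → Even a → Σ ℕ λ k → a ≡ 2 ℕ.* k
even⇒double zero _ = 0 , refl
even⇒double (suc (suc a)) e with even⇒double a (trans (sym (not-involutive _)) e)
... | k , refl = suc k , cong suc (sym (+-suc k (k + 0)))

lookup-injective : ∀ {A : Set} {xs : List A} → Unique xs → ∀ i j → List.lookup xs i ≡ List.lookup xs j → i ≡ j
lookup-injective (_ ∷ _) zero zero _ = refl
lookup-injective (x∉xs ∷ _) zero (suc j) e = ⊥-elim (All.lookup x∉xs (∈-lookup j) e)
lookup-injective (x∉xs ∷ _) (suc i) zero e = ⊥-elim (All.lookup x∉xs (∈-lookup i) (sym e))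
lookup-injective (_ ∷ u) (suc i) (suc j) e = cong suc (lookup-injective u i j e)

-- The pairs (i , j) of elements of Fin k with i < j, listed explicitly, so that a
-- property of all such pairs of a concrete small k can be given as a finite table.
orderedPairs : ∀ k → List (Fin k × Fin k)
orderedPairs zero = []
orderedPairs (suc k) = List.map (λ j → zero , suc j) (allFin k) ++ List.map (Prod.map suc suc) (orderedPairs k)

orderedPairs-complete : ∀ {k} (i j : Fin k) → toℕ i < toℕ j → (i , j) ∈ orderedPairs k
orderedPairs-complete zero (suc j) _ = ∈-++⁺ˡ (∈-map⁺ (λ j → zero , suc j) (∈-allFin j))
orderedPairs-complete {suc k} (suc i) (suc j) i<j =
  ∈-++⁺ʳ _ (∈-map⁺ (Prod.map suc suc) (orderedPairs-complete i j (ℕ.s<s⁻¹ i<j)))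

on-pairs : ∀ {k} (R : Fin k → Fin k → Set) → (∀ {i j} → R i j → R j i) →
  All (uncurry R) (orderedPairs k) → ∀ i j → i ≢ j → R i j
on-pairs R R-sym table i j i≢j with <ᶠ-cmp i j
... | tri< i<j _ _ = All.lookup table (orderedPairs-complete i j i<j)
... | tri≈ _ i≡j _ = ⊥-elim (i≢j i≡j)
... | tri> _ _ j<i = R-sym (All.lookup table (orderedPairs-complete j i j<i))

injective-from-pairs : ∀ {k} {A : Set} (f : Fin k → A) →
  All (λ (i , j) → f i ≢ f j) (orderedPairs k) → Injective _≡_ _≡_ f
injective-from-pairs f table {i} {j} fi≡fj with i ≟ᶠ j
... | yes i≡j = i≡j
... | no i≢j = ⊥-elim (on-pairs (λ i j → f i ≢ f j) (λ ne e → ne (sym e)) table i j i≢j fi≡fj)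

module _ (H G : Graph) (decH : DecidableGraph H) (p : Fin (n H) → Fin (n G)) where

  Faithful : ∀ {i j} → Dec (Adj H i j) → Set
  Faithful {i} {j} (yes _) = Adj G (p i) (p j)
  Faithful {i} {j} (no _) = p i ≢ p j × ¬ Adj G (p i) (p j)

  private
    Reflects : Fin (n H) → Fin (n H) → Set
    Reflects i j = p i ≢ p j × (Adj G (p i) (p j) → Adj H i j) × (Adj H i j → Adj G (p i) (p j))

    reflects-sym : ∀ {i j} → Reflects i j → Reflects j i
    reflects-sym (ne , to , from) = (λ e → ne (sym e)) , (λ a → adj-sym H (to (adj-sym G a))) , (λ a → adj-sym G (from (adj-sym H a)))

    faithful⇒reflects : ∀ {i j} → Faithful (decH i j) → Reflects i j
    faithful⇒reflects {i} {j} f with decH i j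
    ... | yes a = (λ e → irrefl G (subst (λ x → Adj G x (p j)) e f)) , (λ _ → a) , (λ _ → f)
    ... | no ¬a = proj₁ f , (λ g → ⊥-elim (proj₂ f g)) , (λ a → ⊥-elim (¬a a))

  induced-from-pairs : All (λ (i , j) → Faithful (decH i j)) (orderedPairs (n H)) → InducedIn H G
  induced-from-pairs table = p , p-injective , adjacency
    where
    reflects : ∀ i j → i ≢ j → Reflects i j
    reflects = on-pairs Reflects reflects-sym (All.map faithful⇒reflects table)
    p-injective : Injective _≡_ _≡_ p
    p-injective = injective-from-pairs p (All.map proj₁ (All.map faithful⇒reflects table))
    adjacency : ∀ i j → (Adj G (p i) (p j) → Adj H i j) × (Adj H i j → Adj G (p i) (p j))
    adjacency i j with i ≟ᶠ j
    ... | yes refl = (λ a → ⊥-elim (irrefl G a)) , (λ a → ⊥-elim (irrefl H a))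
    ... | no i≢j = proj₂ (reflects i j i≢j)

fromEdges-decidable : ∀ k es → DecidableGraph (fromEdges k es)
fromEdges-decidable k es i j =
  ¬? (i ≟ᶠ j) ×-dec (member? pair? (toℕ i , toℕ j) es ⊎-dec member? pair? (toℕ j , toℕ i) es)
  where
  pair? : (x y : ℕ × ℕ) → Dec (x ≡ y)
  pair? = ≡-dec _≟_ _≟_

module Cycles (K : Graph) where

  private
    V : Set
    V = Fin (n K)

    _~_ : V → V → Set
    _~_ = Adj K

  IsCycle : (L : ℕ) → (Fin L → V) → Set
  IsCycle L c = Injective _≡_ _≡_ c × (∀ k → c k ~ c (next k))

  Chordless : (L : ℕ) → (Fin L → V) → Set
  Chordless L c = ∀ k l → c k ~ c l → Consecutive k l

  induced⇒chordless-cycle : ∀ L (q : 3 ≤ L) (emb : InducedIn (cycle L q) K) →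
    IsCycle L (proj₁ emb) × Chordless L (proj₁ emb)
  induced⇒chordless-cycle L q (c , c-inj , adj) =
    (c-inj , λ k → proj₂ (adj k (next k)) (inj₁ (next⇒CycSucc refl))) ,
    λ k l a → Data.Sum.map CycSucc⇒next CycSucc⇒next (proj₁ (adj k l) a)

  chordless-cycle⇒induced : ∀ L (q : 3 ≤ L) (c : Fin L → V) → IsCycle L c → Chordless L c → InducedIn (cycle L q) K
  chordless-cycle⇒induced L q c (c-inj , c-adj) chordless = c , c-inj , λ i j →
    (λ a → Data.Sum.map next⇒CycSucc next⇒CycSucc (chordless i j a)) ,
    Data.Sum.[ (λ s → subst (λ x → c i ~ c x) (CycSucc⇒next s) (c-adj i)) ,
               (λ s → adj-sym K (subst (λ x → c j ~ c x) (CycSucc⇒next s) (c-adj j))) ]′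

  relabel : ∀ {L} (c : Fin L → V) (σ : Fin L → Fin L) → IsCycle L c → Injective _≡_ _≡_ σ →
    (∀ k → Consecutive (σ k) (σ (next k))) → IsCycle L (λ k → c (σ k))
  relabel c σ (c-inj , c-adj) σ-inj σ-consecutive = (λ e → σ-inj (c-inj e)) , λ k → adjacent k (σ-consecutive k)
    where
    adjacent : ∀ k → Consecutive (σ k) (σ (next k)) → c (σ k) ~ c (σ (next k))
    adjacent k (inj₁ e) = subst (λ x → c (σ k) ~ c x) e (c-adj (σ k))
    adjacent k (inj₂ e) = adj-sym K (subst (λ x → c (σ (next k)) ~ c x) e (c-adj (σ (next k))))

  close-arc : ∀ {L} (c : Fin L → V) → IsCycle L c → (u : Fin L) (d : ℕ) → d < L → c (step d u) ~ c u →
    IsCycle (suc d) (λ t → c (step (toℕ t) u))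
  close-arc c (c-inj , c-adj) u d d<L chord = arc-injective , arc-adjacent
    where
    arc-injective : Injective _≡_ _≡_ (λ (t : Fin (suc d)) → c (step (toℕ t) u))
    arc-injective {s} {t} e = toℕ-injective
      (step-injective (toℕ s) (toℕ t) u (≤-<-trans (ℕ.s≤s⁻¹ (toℕ<n s)) d<L) (≤-<-trans (ℕ.s≤s⁻¹ (toℕ<n t)) d<L) (c-inj e))
    arc-adjacent : ∀ (t : Fin (suc d)) → c (step (toℕ t) u) ~ c (step (toℕ (next t)) u)
    arc-adjacent t with next-cases t
    ... | inj₁ (_ , e) = subst (λ x → c (step (toℕ t) u) ~ c (step x u)) (sym e) (c-adj (step (toℕ t) u))
    ... | inj₂ (e , z) = subst₂ (λ x y → c (step x u) ~ c (step y u)) (sym (suc-injective e)) (sym z) chord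

  module _ (col : V → Bool) (proper : ∀ {x y} → x ~ y → col x ≢ col y) where

    colour-along : ∀ {L} (c : Fin L → V) → IsCycle L c → ∀ a u → col (c (step a u)) ≡ flips a (col (c u))
    colour-along c cyc zero u = refl
    colour-along c cyc (suc a) u =
      trans (¬-not (λ e → proper (proj₂ cyc (step a u)) (sym e))) (cong not (colour-along c cyc a u))

    cycle-even : ∀ {L} (c : Fin L → V) → IsCycle L c → Fin L → Even L
    cycle-even {L} c cyc u = flips-fixed⇒even L (col (c u))
      (trans (sym (colour-along c cyc L u)) (cong (λ x → col (c x)) (step-period u)))

  LongEvenHole : Set
  LongEvenHole = Σ ℕ λ L → Σ (Fin L → V) λ c → IsCycle L c × Chordless L c × 6 ≤ L × Even L

  no-chord-at? : DecidableGraph K → ∀ {L} (c : Fin L → V) k l → Dec (c k ~ c l → Consecutive k l)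
  no-chord-at? dec c k l = dec (c k) (c l) →-dec consecutive? k l

  chordless-or-chord : DecidableGraph K → ∀ L (c : Fin L → V) →
    Chordless L c ⊎ (Σ (Fin L) λ k → Σ (Fin L) λ l → c k ~ c l × ¬ Consecutive k l)
  chordless-or-chord dec L c with all? (λ k → all? (λ l → no-chord-at? dec c k l))
  ... | yes none = inj₁ none
  ... | no some with ¬∀⟶∃¬ L _ (λ k → all? (λ l → no-chord-at? dec c k l)) some
  ...   | k , at-k with ¬∀⟶∃¬ L _ (no-chord-at? dec c k) at-k
  ...     | l , at-kl with dec (c k) (c l)
  ...       | yes a = inj₂ (k , l , a , λ e → at-kl (λ _ → e))
  ...       | no ¬a = ⊥-elim (at-kl (λ a → ⊥-elim (¬a a)))

  -- Path a xs b: a walk a, x₁, …, xₖ = b listing its vertices after the first.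
  data Path : V → List V → V → Set where
    []  : ∀ {a} → Path a [] a
    _∷_ : ∀ {a x xs b} → a ~ x → Path x xs b → Path a (x ∷ xs) b

  _++ᵖ_ : ∀ {a xs b ys c} → Path a xs b → Path b ys c → Path a (xs ++ ys) c
  [] ++ᵖ q = q
  (e ∷ p) ++ᵖ q = e ∷ (p ++ᵖ q)

  closed-path⇒cycle : ∀ {b} xs → Path b xs b → Unique xs → IsCycle (List.length xs) (List.lookup xs)
  closed-path⇒cycle xs p u = (λ {i} {j} → lookup-injective u i j) , adjacent
    where
    first : ∀ {a ys c} → Path a ys c → ∀ k → toℕ k ≡ 0 → a ~ List.lookup ys k
    first (e ∷ _) zero _ = e
    consecutive : ∀ {a ys c} → Path a ys c → ∀ k k' → suc (toℕ k) ≡ toℕ k' → List.lookup ys k ~ List.lookup ys k'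
    consecutive (_ ∷ q) zero (suc k') e = first q k' (sym (suc-injective e))
    consecutive (_ ∷ q) (suc k) (suc k') e = consecutive q k k' (suc-injective e)
    last : ∀ {a ys c} → Path a ys c → ∀ k → suc (toℕ k) ≡ List.length ys → List.lookup ys k ≡ c
    last (_ ∷ []) zero _ = refl
    last (_ ∷ q@(_ ∷ _)) (suc k) e = last q k (suc-injective e)
    adjacent : ∀ k → List.lookup xs k ~ List.lookup xs (next k)
    adjacent k with next-cases k
    ... | inj₁ (_ , e) = consecutive p k (next k) (sym e)
    ... | inj₂ (e , z) = subst (_~ List.lookup xs (next k)) (sym (last p k e)) (first p (next k) z)

-- Each chord splits an even cycle into two even cycles that share it.
module ChordReduction (G : Graph) (dec : DecidableGraph G) (col : Fin (n G) → Bool)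
  (proper : ∀ {x y} → Adj G x y → col x ≢ col y) (Q : Fin (n G) → Set) where

  open Cycles G

  private
    V : Set
    V = Fin (n G)

    _~_ : V → V → Set
    _~_ = Adj G

  Domino : Set
  Domino = Σ (Fin 6 → V) λ c → IsCycle 6 c × c 0F ~ c 3F × (∀ k → Q (c k))

  hexagon⇒domino : ∀ {L} → L ≡ 6 → (c : Fin L → V) → IsCycle L c → (∀ k → Q (c k)) →
    (k : Fin L) → c k ~ c (step 3 k) → Domino
  hexagon⇒domino refl c cyc inQ k chord =
    (λ t → c (step (toℕ t) k)) , close-arc c cyc k 5 (s≤s (s≤s (s≤s (s≤s (s≤s (s≤s z≤n)))))) back , chord ,
    λ t → inQ (step (toℕ t) k)
    where
    back : c (step 5 k) ~ c k
    back = subst (λ x → c (step 5 k) ~ c x) (step-period k) (proj₂ cyc (step 5 k))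

  Reducible : ℕ → Set
  Reducible L = (c : Fin L → V) → IsCycle L c → (∀ k → Q (c k)) → 6 ≤ L → LongEvenHole ⊎ Domino

  -- The chord c k c (k + d), 2 ≤ d ≤ L - 2, splits the cycle into the cycles
  -- c k, …, c (k + d) of length d + 1 and c (k + d), …, c k of length e + 1, e = L - d.
  -- Both are shorter and even; if neither has length ≥ 6 both are 4-cycles, so L = 6, d = 3.
  reduce-at-chord : ∀ L → (∀ {L'} → L' < L → Reducible L') → (c : Fin L → V) → IsCycle L c → (∀ k → Q (c k)) →
    (k : Fin L) (d : ℕ) → 2 ≤ d → suc (suc d) ≤ L → c k ~ c (step d k) → LongEvenHole ⊎ Domino
  reduce-at-chord L shorter c cyc inQ k d 2≤d d+2≤L chord = choose (6 ℕ.≤? suc d) (6 ℕ.≤? suc e)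
    where
    d<L : d < L
    d<L = ≤-trans (n≤1+n (suc d)) d+2≤L
    l : Fin L
    l = step d k
    e : ℕ
    e = L ∸ d
    e+d≡L : e + d ≡ L
    e+d≡L = m∸n+n≡m (<⇒≤ d<L)
    e<L : e < L
    e<L = ∸-monoʳ-< {m = L} {n = d} {o = 0} (≤-trans (s≤s z≤n) 2≤d) (<⇒≤ d<L)
    e+2≤L : suc (suc e) ≤ L
    e+2≤L = subst₂ _≤_ (+-comm e 2) e+d≡L (+-monoʳ-≤ e 2≤d)
    2≤e : 2 ≤ e
    2≤e = +-cancelʳ-≤ d 2 e (subst (suc (suc d) ≤_) (sym e+d≡L) d+2≤L)
    C₁ : Fin (suc d) → V
    C₁ t = c (step (toℕ t) k)
    cyc₁ : IsCycle (suc d) C₁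
    cyc₁ = close-arc c cyc k d d<L (adj-sym G chord)
    around : step e l ≡ k
    around = trans (sym (step-+ e d k)) (trans (cong (λ x → step x k) e+d≡L) (step-period k))
    C₂ : Fin (suc e) → V
    C₂ t = c (step (toℕ t) l)
    cyc₂ : IsCycle (suc e) C₂
    cyc₂ = close-arc c cyc l e e<L (subst (λ x → c x ~ c l) (sym around) chord)
    choose : Dec (6 ≤ suc d) → Dec (6 ≤ suc e) → LongEvenHole ⊎ Domino
    choose (yes 6≤d+1) _ = shorter d+2≤L C₁ cyc₁ (λ t → inQ (step (toℕ t) k)) 6≤d+1
    choose (no _) (yes 6≤e+1) = shorter e+2≤L C₂ cyc₂ (λ t → inQ (step (toℕ t) l)) 6≤e+1
    choose (no d+1≱6) (no e+1≱6) = inj₂ (hexagon⇒domino L≡6 c cyc inQ k (subst (λ x → c k ~ c (step x k)) d≡3 chord))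
      where
      d≡3 : d ≡ 3
      d≡3 = suc-injective (even-3-5 (suc d) (s≤s 2≤d) (≰⇒> d+1≱6) (cycle-even col proper C₁ cyc₁ zero))
      e≡3 : e ≡ 3
      e≡3 = suc-injective (even-3-5 (suc e) (s≤s 2≤e) (≰⇒> e+1≱6) (cycle-even col proper C₂ cyc₂ zero))
      L≡6 : L ≡ 6
      L≡6 = trans (sym e+d≡L) (cong₂ _+_ e≡3 d≡3)

  reduce-step : ∀ L → (∀ {L'} → L' < L → Reducible L') → Reducible L
  reduce-step L shorter c cyc inQ 6≤L with chordless-or-chord dec L c
  ... | inj₁ chordless = inj₁ (L , c , cyc , chordless , 6≤L , cycle-even col proper c cyc (fromℕ< (≤-trans (s≤s z≤n) 6≤L)))
  ... | inj₂ (k , l , chord , not-consecutive) with step-reaches k l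
  ...   | zero , _ , refl = ⊥-elim (irrefl G chord)
  ...   | suc zero , _ , refl = ⊥-elim (not-consecutive (inj₁ refl))
  ...   | suc (suc d) , d<L , refl with m≤n⇒m<n∨m≡n d<L
  ...     | inj₁ d+2≤L = reduce-at-chord L shorter c cyc inQ k (suc (suc d)) (s≤s (s≤s z≤n)) d+2≤L chord
  ...     | inj₂ d+1≡L = ⊥-elim (not-consecutive (inj₂ (trans (cong (λ x → step x k) d+1≡L) (step-period k))))

  reduce : ∀ L → Reducible L
  reduce = <-rec Reducible reduce-step

no-four-neighbours : ∀ (G : Graph) → MaxDegree≤3 G → ∀ {v} a b c d →
  a ≢ b → a ≢ c → a ≢ d → b ≢ c → b ≢ d → c ≢ d → Adj G v a → Adj G v b → Adj G v c → Adj G v d → ⊥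
no-four-neighbours G deg a b c d a≢b a≢c a≢d b≢c b≢d c≢d va vb vc vd =
  deg _ f (injective-from-pairs f (a≢b ∷ a≢c ∷ a≢d ∷ b≢c ∷ b≢d ∷ c≢d ∷ [])) adjacent
  where
  f : Fin 4 → Fin (n G)
  f = Vec.lookup (a ∷ b ∷ c ∷ d ∷ [])
  adjacent : ∀ i → Adj G _ (f i)
  adjacent 0F = va
  adjacent 1F = vb
  adjacent 2F = vc
  adjacent 3F = vd

-- The symmetries of the hexagon on positions Fin 6 used to put a domino in standard
-- position; that a table is such a symmetry is checked by computation.
HexagonSymmetry : (Fin 6 → Fin 6) → Set
HexagonSymmetry σ = All (λ (i , j) → σ i ≢ σ j) (orderedPairs 6) × (∀ k → Consecutive (σ k) (σ (next k)))

hexagon-symmetry? : ∀ σ → Dec (HexagonSymmetry σ)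
hexagon-symmetry? σ = All.all? (λ (i , j) → ¬? (σ i ≟ᶠ σ j)) (orderedPairs 6) ×-dec
  all? λ k → consecutive? (σ k) (σ (next k))

-- Each pair of
-- consecutive vertices h i, h (i + 1) is joined in G by an edge or, when not adjacent, through
-- a bridge vertex.  Inserting the bridges turns h into a cycle of G through the lift vertices.
module Lift (G : Graph) (dec : DecidableGraph G) (col : Fin (n G) → Bool)
  (proper : ∀ {x y} → Adj G x y → col x ≢ col y) (deg : MaxDegree≤3 G)
  (m : ℕ) (4≤m : 4 ≤ m) (h : Fin m → Fin (n G))
  (hole : Cycles.IsCycle (square G) m h) (hole-chordless : Cycles.Chordless (square G) m h) where

  V : Set
  V = Fin (n G)

  _~_ : V → V → Set
  _~_ = Adj G

  _~²_ : V → V → Set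
  _~²_ = Adj (square G)

  next-moves : ∀ (x : Fin m) → next x ≢ x
  next-moves x = step-moves 1 x (s≤s z≤n) (≤-trans (s≤s (s≤s z≤n)) 4≤m)

  next²-moves : ∀ (x : Fin m) → next (next x) ≢ x
  next²-moves x = step-moves 2 x (s≤s z≤n) (≤-trans (s≤s (s≤s (s≤s z≤n))) 4≤m)

  next³-moves : ∀ (x : Fin m) → next (next (next x)) ≢ x
  next³-moves x = step-moves 3 x (s≤s z≤n) 4≤m

  same-direction : ∀ {x y z : Fin m} → Consecutive x y → Consecutive y z → x ≢ z →
    (next x ≡ y × next y ≡ z) ⊎ (next y ≡ x × next z ≡ y)
  same-direction (inj₁ a) (inj₁ b) _ = inj₁ (a , b)
  same-direction (inj₁ a) (inj₂ b) x≢z = ⊥-elim (x≢z (next-injective (trans a (sym b))))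
  same-direction (inj₂ a) (inj₁ b) x≢z = ⊥-elim (x≢z (trans (sym a) b))
  same-direction (inj₂ a) (inj₂ b) _ = inj₂ (a , b)

  no-triangle : ∀ {a b c : Fin m} → a ≢ c → Consecutive a b → Consecutive b c → Consecutive c a → ⊥
  no-triangle {a} {b} {c} a≢c ab bc ca with same-direction ab bc a≢c | ca
  ... | inj₁ (e₁ , e₂) | inj₁ e₃ = next³-moves a (trans (cong next (trans (cong next e₁) e₂)) e₃)
  ... | inj₁ (e₁ , e₂) | inj₂ e₃ = next-moves b (trans e₂ (trans (sym e₃) e₁))
  ... | inj₂ (e₁ , e₂) | inj₂ e₃ = next³-moves c (trans (cong next (trans (cong next e₂) e₁)) e₃)
  ... | inj₂ (e₁ , e₂) | inj₁ e₃ = next-moves b (trans e₁ (trans (sym e₃) e₂))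

  edge⇒square : ∀ {a b} → a ~ b → a ~² b
  edge⇒square a~b = (λ e → irrefl G (subst (_~ _) e a~b)) , inj₁ a~b

  path⇒square : ∀ {a z b} → a ~ z → z ~ b → a ≢ b → a ~² b
  path⇒square {z = z} a~z z~b a≢b = a≢b , inj₂ (z , a~z , z~b)

  h≢ : ∀ {i j} → i ≢ j → h i ≢ h j
  h≢ i≢j e = i≢j (proj₁ hole e)

  edge⇒consecutive : ∀ {i j} → h i ~ h j → Consecutive i j
  edge⇒consecutive a = hole-chordless _ _ (edge⇒square a)

  path⇒consecutive : ∀ {i j z} → i ≢ j → h i ~ z → z ~ h j → Consecutive i j
  path⇒consecutive i≢j a b = hole-chordless _ _ (path⇒square a b (h≢ i≢j))

  data Link (a b : V) : Set where
    edge : a ~ b → Link a b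
    via  : (z : V) → ¬ a ~ b → a ~ z → z ~ b → Link a b

  square⇒link : ∀ a b → a ~² b → Link a b
  square⇒link a b a~²b with dec a b | a~²b
  ... | yes a~b | _ = edge a~b
  ... | no ¬a~b | _ , inj₁ a~b = ⊥-elim (¬a~b a~b)
  ... | no ¬a~b | _ , inj₂ (z , a~z , z~b) = via z ¬a~b a~z z~b

  IsVia : ∀ {a b} → Link a b → Set
  IsVia (edge _) = ⊥
  IsVia (via _ _ _ _) = ⊤

  after before : ∀ {a b} → Link a b → V
  after {b = b} (edge _) = b
  after (via z _ _ _) = z
  before {a = a} (edge _) = a
  before (via z _ _ _) = z

  -- The link from h i to h (i + 1); its bridge vertex, if any, is leaving i = entering i.
  link : (i : Fin m) → Link (h i) (h (next i))
  link i = square⇒link (h i) (h (next i)) (proj₂ hole i)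

  Via : Fin m → Set
  Via i = IsVia (link i)

  leaving entering : Fin m → V
  leaving i = after (link i)
  entering i = before (link i)

  via? : ∀ {a b} (l : Link a b) → Dec (IsVia l)
  via? (edge _) = no (λ ())
  via? (via _ _ _ _) = yes tt

  via-left : ∀ {a b} (l : Link a b) → IsVia l → a ~ after l
  via-left (via _ _ a~z _) _ = a~z

  via-right : ∀ {a b} (l : Link a b) → IsVia l → after l ~ b
  via-right (via _ _ _ z~b) _ = z~b

  via-nonadjacent : ∀ {a b} (l : Link a b) → IsVia l → ¬ a ~ b
  via-nonadjacent (via _ ¬a~b _ _) _ = ¬a~b

  via-before : ∀ {a b} (l : Link a b) → IsVia l → before l ≡ after l
  via-before (via _ _ _ _) _ = refl

  edge-adjacent : ∀ {a b} (l : Link a b) → ¬ IsVia l → a ~ b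
  edge-adjacent (edge a~b) _ = a~b
  edge-adjacent (via _ _ _ _) ¬via = ⊥-elim (¬via tt)

  edge-after : ∀ {a b} (l : Link a b) → ¬ IsVia l → after l ≡ b
  edge-after (edge _) _ = refl
  edge-after (via _ _ _ _) ¬via = ⊥-elim (¬via tt)

  edge-before : ∀ {a b} (l : Link a b) → ¬ IsVia l → before l ≡ a
  edge-before (edge _) _ = refl
  edge-before (via _ _ _ _) ¬via = ⊥-elim (¬via tt)

  bridge-neighbours : ∀ {i j} → Via j → h i ~ leaving j → i ≡ j ⊎ i ≡ next j
  bridge-neighbours {i} {j} v a with i ≟ᶠ j | i ≟ᶠ next j
  ... | yes e | _ = inj₁ e
  ... | no _ | yes e = inj₂ e
  ... | no i≢j | no i≢j+1 = ⊥-elim (no-triangle i≢j+1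
          (path⇒consecutive i≢j a (adj-sym G (via-left (link j) v))) (inj₁ refl)
          (path⇒consecutive (λ e → i≢j+1 (sym e)) (adj-sym G (via-right (link j) v)) (adj-sym G a)))

  -- A bridge is not a hole vertex: otherwise it would give a triangle of consecutive positions.
  bridge-off-hole : ∀ {i j} → Via j → leaving j ≢ h i
  bridge-off-hole {i} {j} v e = no-triangle (λ e' → next-moves j (sym e'))
    (edge⇒consecutive (subst (h j ~_) e (via-left (link j) v)))
    (edge⇒consecutive (subst (_~ h (next j)) e (via-right (link j) v))) (inj₂ refl)

  bridge-injective : ∀ {i j} → Via i → Via j → leaving i ≡ leaving j → i ≡ j
  bridge-injective {i} {j} vi vj e
    with bridge-neighbours {i} {j} vj (subst (h i ~_) e (via-left (link i) vi))
       | bridge-neighbours {next i} {j} vj (adj-sym G (subst (_~ h (next i)) e (via-right (link i) vi)))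
  ... | inj₁ i≡j | _ = i≡j
  ... | inj₂ _ | inj₂ e₂ = next-injective e₂
  ... | inj₂ e₁ | inj₁ e₂ = ⊥-elim (next²-moves j (trans (cong next (sym e₁)) e₂))

  OnLift : V → Set
  OnLift v = (Σ (Fin m) λ j → v ≡ h j) ⊎ (Σ (Fin m) λ j → Via j × v ≡ leaving j)

  BackwardOf : Fin m → V → Set
  BackwardOf i w = Σ (Fin m) λ j → next j ≡ i × w ≡ entering j

  lift-neighbour : ∀ {i w} → OnLift w → h i ~ w → w ≡ leaving i ⊎ BackwardOf i w
  lift-neighbour {i} (inj₁ (j , refl)) a with edge⇒consecutive a
  ... | inj₁ refl with via? (link i)
  ...   | yes v = ⊥-elim (via-nonadjacent (link i) v a)
  ...   | no ¬v = inj₁ (sym (edge-after (link i) ¬v))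
  lift-neighbour {i} (inj₁ (j , refl)) a | inj₂ refl with via? (link j)
  ...   | yes v = ⊥-elim (via-nonadjacent (link j) v (adj-sym G a))
  ...   | no ¬v = inj₂ (j , refl , sym (edge-before (link j) ¬v))
  lift-neighbour (inj₂ (j , v , refl)) a with bridge-neighbours v a
  ... | inj₁ refl = inj₁ refl
  ... | inj₂ refl = inj₂ (j , refl , sym (via-before (link j) v))

  -- h i has only one preceding link, so only one backward lift neighbour.
  backward-unique : ∀ {i w w'} → BackwardOf i w → BackwardOf i w' → w ≡ w'
  backward-unique (j , e , refl) (j' , e' , refl) = cong entering (next-injective (trans e (sym e')))

  hole-vertex-lift-degree : ∀ {i a b c} → OnLift a → OnLift b → OnLift c → h i ~ a → h i ~ b → h i ~ c →
    a ≢ b → b ≢ c → a ≢ c → ⊥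
  hole-vertex-lift-degree la lb lc pa pb pc a≢b b≢c a≢c
    with lift-neighbour la pa | lift-neighbour lb pb | lift-neighbour lc pc
  ... | inj₁ x | inj₁ y | _ = a≢b (trans x (sym y))
  ... | inj₁ x | inj₂ _ | inj₁ z = a≢c (trans x (sym z))
  ... | inj₁ _ | inj₂ y | inj₂ z = b≢c (backward-unique y z)
  ... | inj₂ _ | inj₁ y | inj₁ z = b≢c (trans y (sym z))
  ... | inj₂ x | inj₁ _ | inj₂ z = a≢c (backward-unique x z)
  ... | inj₂ x | inj₂ y | _ = a≢b (backward-unique x y)

  -- A bridge already has the two hole vertices it joins as neighbours, so by the degree
  -- bound two further distinct lift neighbours cannot both be bridges.
  bridge-lift-neighbours : ∀ {a w w'} → Via a → OnLift w → OnLift w' → leaving a ~ w → leaving a ~ w' → w ≢ w' →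
    (Σ (Fin m) λ j → w ≡ h j) ⊎ (Σ (Fin m) λ j → w' ≡ h j)
  bridge-lift-neighbours _ (inj₁ x) _ _ _ _ = inj₁ x
  bridge-lift-neighbours _ (inj₂ _) (inj₁ x) _ _ _ = inj₂ x
  bridge-lift-neighbours {a} va (inj₂ (c , vc , refl)) (inj₂ (c' , vc' , refl)) p p' w≢w' =
    ⊥-elim (no-four-neighbours G deg (h a) (h (next a)) (leaving c) (leaving c')
      (h≢ (λ e → next-moves a (sym e))) (λ e → bridge-off-hole vc (sym e)) (λ e → bridge-off-hole vc' (sym e))
      (λ e → bridge-off-hole vc (sym e)) (λ e → bridge-off-hole vc' (sym e)) w≢w'
      (adj-sym G (via-left (link a) va)) (via-right (link a) va) p p')

  three-lift-neighbours⇒bridge : ∀ {v a b c} → OnLift v → OnLift a → OnLift b → OnLift c → v ~ a → v ~ b → v ~ c →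
    a ≢ b → b ≢ c → a ≢ c → Σ (Fin m) λ i → Via i × v ≡ leaving i
  three-lift-neighbours⇒bridge (inj₁ (j , refl)) la lb lc pa pb pc a≢b b≢c a≢c =
    ⊥-elim (hole-vertex-lift-degree la lb lc pa pb pc a≢b b≢c a≢c)
  three-lift-neighbours⇒bridge (inj₂ x) _ _ _ _ _ _ _ _ _ = x

  beside-bridge⇒hole-vertex : ∀ {a b w w'} → Via a → Via b → OnLift w → OnLift w' → w' ≡ leaving b →
    leaving a ~ w → leaving a ~ w' → w ≢ w' → Σ (Fin m) λ j → w ≡ h j
  beside-bridge⇒hole-vertex va vb lw lw' e p p' w≢w' with bridge-lift-neighbours va lw lw' p p' w≢w'
  ... | inj₁ x = x
  ... | inj₂ (j , e') = ⊥-elim (bridge-off-hole vb (trans (sym e) e'))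

  open Cycles G

  block : ∀ {a b} → Link a b → List V
  block {b = b} (edge _) = b ∷ []
  block {b = b} (via z _ _ _) = z ∷ b ∷ []

  block-path : ∀ {a b} (l : Link a b) → Path a (block l) b
  block-path (edge a~b) = a~b ∷ []
  block-path (via _ _ a~z z~b) = a~z ∷ (z~b ∷ [])

  block-unique : ∀ {a b} (l : Link a b) → Unique (block l)
  block-unique (edge _) = [] ∷ []
  block-unique (via z _ _ z~b) = ((λ e → irrefl G (subst (z ~_) (sym e) z~b)) ∷ []) ∷ [] ∷ []

  block-members : ∀ {a b v} (l : Link a b) → v ∈ block l → v ≡ b ⊎ (IsVia l × v ≡ after l)
  block-members (edge _) (here e) = inj₁ e
  block-members (via _ _ _ _) (here e) = inj₂ (tt , e)
  block-members (via _ _ _ _) (there (here e)) = inj₁ e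

  block-length : ∀ {a b} (l : Link a b) → 1 ≤ length (block l)
  block-length (edge _) = s≤s z≤n
  block-length (via _ _ _ _) = s≤s z≤n

  via-block-length : ∀ {a b} (l : Link a b) → IsVia l → 2 ≤ length (block l)
  via-block-length (via _ _ _ _) _ = s≤s (s≤s z≤n)

  blocks-disjoint : ∀ {i j} → i ≢ j → Disjoint (block (link i)) (block (link j))
  blocks-disjoint {i} {j} i≢j (vi , vj) with block-members (link i) vi | block-members (link j) vj
  ... | inj₁ e | inj₁ e' = i≢j (next-injective (proj₁ hole (trans (sym e) e')))
  ... | inj₁ e | inj₂ (v' , e') = bridge-off-hole v' (trans (sym e') e)
  ... | inj₂ (v , e) | inj₁ e' = bridge-off-hole v (trans (sym e) e')
  ... | inj₂ (v , e) | inj₂ (v' , e') = i≢j (bridge-injective v v' (trans (sym e) e'))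

  links-path : ∀ k (f : ℕ → Fin m) → (∀ a → f (suc a) ≡ next (f a)) →
    Path (h (f 0)) (concat (applyUpTo (λ a → block (link (f a))) k)) (h (f k))
  links-path zero f _ = []
  links-path (suc k) f f-next =
    subst (λ x → Path (h (f 0)) (block (link (f 0))) (h x)) (sym (f-next 0)) (block-path (link (f 0)))
      ++ᵖ links-path k (λ a → f (suc a)) (λ a → f-next (suc a))

  links-length : ∀ k (g : ℕ → List V) → (∀ a → 1 ≤ length (g a)) → k ≤ length (concat (applyUpTo g k))
  links-length zero g _ = z≤n
  links-length (suc k) g g≥1 = subst (suc k ≤_) (sym (length-++ (g 0)))
    (+-mono-≤ (g≥1 0) (links-length k (λ a → g (suc a)) (λ a → g≥1 (suc a))))

  -- Two consecutive links cannot both be edges of G: h i and h (i + 2) would be at distance 2.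
  some-via : ∀ i → Via i ⊎ Via (next i)
  some-via i with via? (link i) | via? (link (next i))
  ... | yes v | _ = inj₁ v
  ... | no _ | yes v = inj₂ v
  ... | no ¬v | no ¬v' with path⇒consecutive (λ e → next²-moves i (sym e)) (edge-adjacent (link i) ¬v) (edge-adjacent (link (next i)) ¬v')
  ...   | inj₁ e = ⊥-elim (next-moves i (sym (next-injective e)))
  ...   | inj₂ e = ⊥-elim (next³-moves i e)

  start : Σ (Fin m) Via
  start with some-via (fromℕ< (≤-trans (s≤s z≤n) 4≤m))
  ... | inj₁ v = _ , v
  ... | inj₂ v = _ , v

  liftBlocks : List (List V)
  liftBlocks = applyUpTo (λ a → block (link (step a (proj₁ start)))) m

  lift : List V
  lift = concat liftBlocks

  lift-path : Path (h (proj₁ start)) lift (h (proj₁ start))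
  lift-path = subst (λ x → Path (h (proj₁ start)) lift (h x)) (step-period (proj₁ start))
    (links-path m (λ a → step a (proj₁ start)) (λ _ → refl))

  lift-unique : Unique lift
  lift-unique = Unique.concat⁺
    (All.applyUpTo⁺₂ _ m (λ a → block-unique (link (step a (proj₁ start)))))
    (AllPairs.applyUpTo⁺₁ _ m λ {a} {b} a<b b<m →
      blocks-disjoint (λ e → <-irrefl (step-injective a b _ (<-trans a<b b<m) b<m e) a<b))

  lift-length : 5 ≤ length lift
  lift-length = long m 4≤m
    where
    g : ℕ → List V
    g a = block (link (step a (proj₁ start)))
    long : ∀ k → 4 ≤ k → 5 ≤ length (concat (applyUpTo g k))
    long (suc k) (s≤s 3≤k) = subst (5 ≤_) (sym (length-++ (g 0)))
      (+-mono-≤ (via-block-length (link (proj₁ start)) (proj₂ start)) (≤-trans 3≤k (links-length k _ (λ a → block-length (link _)))))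

  lift-on : ∀ {v} → v ∈ lift → OnLift v
  lift-on v∈ with ∈-concat⁻′ liftBlocks v∈
  ... | xs , v∈xs , xs∈ with ∈-applyUpTo⁻ _ xs∈
  ...   | a , _ , refl with block-members (link (step a (proj₁ start))) v∈xs
  ...     | inj₁ e = inj₁ (_ , e)
  ...     | inj₂ (v , e) = inj₂ (_ , v , e)

  lift-cycle : IsCycle (length lift) (List.lookup lift)
  lift-cycle = closed-path⇒cycle lift lift-path lift-unique

  open ChordReduction G dec col proper OnLift using (Domino; reduce)

  -- The lift, an even cycle of length ≥ 5 and hence ≥ 6, reduces to a long even hole or a domino.
  lift-reduces : LongEvenHole ⊎ Domino
  lift-reduces = reduce (length lift) (List.lookup lift) lift-cycle (λ k → lift-on (∈-lookup k))
    (even-≥5 _ lift-length (cycle-even col proper _ lift-cycle (fromℕ< (≤-trans (s≤s z≤n) lift-length))))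

  HoleAt : (Fin 6 → V) → Fin 6 → Set
  HoleAt c k = Σ (Fin m) λ j → c k ≡ h j

  -- In a domino of the lift, the chord ends c₀, c₃ have three lift neighbours and so are
  -- bridges; hence their other neighbours c₁, c₅ and c₂, c₄ are hole vertices.
  domino-hole-vertices : ∀ (c : Fin 6 → V) → IsCycle 6 c → c 0F ~ c 3F → (∀ k → OnLift (c k)) →
    HoleAt c 1F × HoleAt c 2F × HoleAt c 4F × HoleAt c 5F
  domino-hole-vertices c (c-inj , c-adj) chord on =
    beside-bridge⇒hole-vertex (proj₁ (proj₂ α)) (proj₁ (proj₂ β)) (on 1F) (on 3F) (proj₂ (proj₂ β)) (at-α (c-adj 0F)) (at-α chord) (distinct (λ ())) ,
    beside-bridge⇒hole-vertex (proj₁ (proj₂ β)) (proj₁ (proj₂ α)) (on 2F) (on 0F) (proj₂ (proj₂ α)) (at-β (adj-sym G (c-adj 2F))) (at-β (adj-sym G chord)) (distinct (λ ())) ,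
    beside-bridge⇒hole-vertex (proj₁ (proj₂ β)) (proj₁ (proj₂ α)) (on 4F) (on 0F) (proj₂ (proj₂ α)) (at-β (c-adj 3F)) (at-β (adj-sym G chord)) (distinct (λ ())) ,
    beside-bridge⇒hole-vertex (proj₁ (proj₂ α)) (proj₁ (proj₂ β)) (on 5F) (on 3F) (proj₂ (proj₂ β)) (at-α (adj-sym G (c-adj 5F))) (at-α chord) (distinct (λ ()))
    where
    distinct : ∀ {k l} → k ≢ l → c k ≢ c l
    distinct k≢l e = k≢l (c-inj e)
    α : Σ (Fin m) λ i → Via i × c 0F ≡ leaving i
    α = three-lift-neighbours⇒bridge (on 0F) (on 1F) (on 3F) (on 5F) (c-adj 0F) chord (adj-sym G (c-adj 5F))
          (distinct (λ ())) (distinct (λ ())) (distinct (λ ()))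
    β : Σ (Fin m) λ i → Via i × c 3F ≡ leaving i
    β = three-lift-neighbours⇒bridge (on 3F) (on 2F) (on 4F) (on 0F) (adj-sym G (c-adj 2F)) (c-adj 3F) (adj-sym G chord)
          (distinct (λ ())) (distinct (λ ())) (distinct (λ ()))
    at-α : ∀ {x} → c 0F ~ x → leaving (proj₁ α) ~ x
    at-α = subst (_~ _) (proj₂ (proj₂ α))
    at-β : ∀ {x} → c 3F ~ x → leaving (proj₁ β) ~ x
    at-β = subst (_~ _) (proj₂ (proj₂ β))

  next⁴-moves : 5 ≤ m → ∀ (x : Fin m) → next (next (next (next x))) ≢ x
  next⁴-moves 5≤m x = step-moves 4 x (s≤s z≤n) 5≤m

  no-square : 5 ≤ m → ∀ {a b c d : Fin m} → a ≢ c → b ≢ d →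
    Consecutive a b → Consecutive b c → Consecutive c d → Consecutive d a → ⊥
  no-square 5≤m {a} {b} {c} {d} a≢c b≢d ab bc cd da
    with same-direction ab bc a≢c | same-direction bc cd b≢d | same-direction cd da (λ e → a≢c (sym e))
  ... | inj₁ (x₁ , x₂) | inj₁ (_ , y₂) | inj₁ (_ , z₂) = next⁴-moves 5≤m a (trans (cong next (trans (cong next (trans (cong next x₁) x₂)) y₂)) z₂)
  ... | inj₁ (_ , x₂) | inj₂ (y₁ , _) | _ = next²-moves b (trans (cong next x₂) y₁)
  ... | inj₂ (_ , x₂) | inj₁ (y₁ , _) | _ = next²-moves c (trans (cong next x₂) y₁)
  ... | inj₁ _ | inj₁ (_ , y₂) | inj₂ (z₁ , _) = next²-moves c (trans (cong next y₂) z₁)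
  ... | inj₂ _ | inj₂ (y₁ , _) | inj₁ (z₁ , _) = b≢d (trans (sym y₁) z₁)
  ... | inj₂ (x₁ , x₂) | inj₂ _ | inj₂ (z₁ , z₂) = next⁴-moves 5≤m a (trans (cong next (trans (cong next (trans (cong next z₂) z₁)) x₂)) x₁)

  -- Hence, for holes of length ≥ 5, the lift contains no domino: its four hole vertices
  -- would be pairwise at distance ≤ 2 around a square.
  no-domino : 5 ≤ m → ¬ Domino
  no-domino 5≤m (c , cyc@(c-inj , c-adj) , chord , on) with domino-hole-vertices c cyc chord on
  ... | (i₁ , e₁) , (i₂ , e₂) , (i₄ , e₄) , (i₅ , e₅) =
    no-square 5≤m (apart e₁ e₄ (λ ())) (apart e₂ e₅ (λ ()))
      (edge⇒consecutive (subst₂ _~_ e₁ e₂ (c-adj 1F)))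
      (path⇒consecutive {z = c 3F} (apart e₂ e₄ (λ ())) (subst (_~ _) e₂ (c-adj 2F)) (subst (_ ~_) e₄ (c-adj 3F)))
      (edge⇒consecutive (subst₂ _~_ e₄ e₅ (c-adj 4F)))
      (path⇒consecutive {z = c 0F} (apart e₅ e₁ (λ ())) (subst (_~ _) e₅ (c-adj 5F)) (subst (_ ~_) e₁ (c-adj 0F)))
    where
    apart : ∀ {k l x y} → c k ≡ h x → c l ≡ h y → k ≢ l → x ≢ y
    apart ek el k≢l x≡y = k≢l (c-inj (trans ek (trans (cong h x≡y) (sym el))))

  -- Part (ii): the hole is the 4-cycle of an induced A₄ of G², whose pendant vertex v₅ is
  -- adjacent in G² to h t only.  Then a domino of the lift extends to an induced H₄ of G.
  module Pendant (t : Fin m) (v₅ : V) (v₅~²t : v₅ ~² h t) (v₅-far : ∀ j → j ≢ t → ¬ v₅ ~² h j)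
    (v₅-off : ∀ j → v₅ ≢ h j) where

    -- v₅ is not adjacent to h t, since h t has a hole neighbour, which v₅ would reach in two steps.
    pendant-nonadjacent : ∀ {j} → j ≢ t → h t ~ h j → ¬ v₅ ~ h t
    pendant-nonadjacent {j} j≢t a p = v₅-far j j≢t (path⇒square p a (v₅-off j))

    pendant-path : ∀ {j} → j ≢ t → h t ~ h j → Σ V λ w → v₅ ~ w × w ~ h t
    pendant-path j≢t a = through v₅~²t
      where
      through : v₅ ~² h t → Σ V λ w → v₅ ~ w × w ~ h t
      through (_ , inj₁ v₅~t) = ⊥-elim (pendant-nonadjacent j≢t a v₅~t)
      through (_ , inj₂ middle) = middle

    far-edge : ∀ {j} → j ≢ t → ¬ h j ~ v₅
    far-edge {j} j≢t a = v₅-far j j≢t (edge⇒square (adj-sym G a))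

    far-path : ∀ {j x} → j ≢ t → h j ~ x → ¬ x ~ v₅
    far-path {j} j≢t a b = v₅-far j j≢t (path⇒square (adj-sym G b) (adj-sym G a) (v₅-off j))

    two-apart : ∀ {x y z} → x ~ y → y ~ z → ¬ x ~ z
    two-apart a b c = proper c (trans (¬-not (proper a)) (trans (cong not (¬-not (proper b))) (not-involutive _)))

    domino⇒H₄ : ∀ (d : Fin 6 → V) → IsCycle 6 d → d 1F ~ d 4F →
      HoleAt d 0F → HoleAt d 2F → d 3F ≡ h t → HoleAt d 5F → InducedIn H₄ G
    domino⇒H₄ d (d-inj , d-adj) chord (j₀ , e₀) (j₂ , e₂) e₃ (j₅ , e₅) =
      induced-from-pairs H₄ G (fromEdges-decidable 8 _) p
        ( d-adj 0F ∷ (d≢ (λ ()) , two-apart (d-adj 0F) (d-adj 1F)) ∷ (d≢ (λ ()) , ¬d₀~d₃)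
        ∷ (d≢ (λ ()) , two-apart (adj-sym G (d-adj 5F)) (adj-sym G (d-adj 4F))) ∷ adj-sym G (d-adj 5F)
        ∷ hole-apart-w e₀ j₀≢t ∷ hole-apart-v₅ e₀ j₀≢t
        ∷ d-adj 1F ∷ (d≢ (λ ()) , two-apart (d-adj 1F) (d-adj 2F)) ∷ chord
        ∷ (d≢ (λ ()) , two-apart (adj-sym G (d-adj 0F)) (adj-sym G (d-adj 5F))) ∷ (d₁≢w , ¬d₁~w) ∷ (d₁≢v₅ , ¬d₁~v₅)
        ∷ d-adj 2F ∷ (d≢ (λ ()) , two-apart (d-adj 2F) (d-adj 3F)) ∷ (d≢ (λ ()) , ¬d₂~d₅)
        ∷ hole-apart-w e₂ j₂≢t ∷ hole-apart-v₅ e₂ j₂≢t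
        ∷ d-adj 3F ∷ (d≢ (λ ()) , two-apart (d-adj 3F) (d-adj 4F)) ∷ d₃~w
        ∷ (d₃≢v₅ , λ a → ¬v₅~d₃ (adj-sym G a))
        ∷ d-adj 4F ∷ (d₄≢w , ¬d₄~w) ∷ (d₄≢v₅ , ¬d₄~v₅)
        ∷ hole-apart-w e₅ j₅≢t ∷ hole-apart-v₅ e₅ j₅≢t
        ∷ adj-sym G v₅~w ∷ [])
      where
      d≢ : ∀ {k l} → k ≢ l → d k ≢ d l
      d≢ k≢l e = k≢l (d-inj e)
      index≢t : ∀ {k j} → d k ≡ h j → k ≢ 3F → j ≢ t
      index≢t {k} e k≢3 j≡t = d≢ k≢3 (trans e (trans (cong h j≡t) (sym e₃)))
      j₀≢t : j₀ ≢ t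
      j₀≢t = index≢t e₀ (λ ())
      j₂≢t : j₂ ≢ t
      j₂≢t = index≢t e₂ (λ ())
      j₅≢t : j₅ ≢ t
      j₅≢t = index≢t e₅ (λ ())
      pendant : Σ V λ w → v₅ ~ w × w ~ h t
      pendant = pendant-path j₂≢t (subst₂ _~_ e₃ e₂ (adj-sym G (d-adj 2F)))
      w : V
      w = proj₁ pendant
      v₅~w : v₅ ~ w
      v₅~w = proj₁ (proj₂ pendant)
      w~t : w ~ h t
      w~t = proj₂ (proj₂ pendant)
      p : Fin 8 → V
      p = Vec.lookup (d 0F ∷ d 1F ∷ d 2F ∷ d 3F ∷ d 4F ∷ d 5F ∷ w ∷ v₅ ∷ [])
      index≢ : ∀ {k l x y} → d k ≡ h x → d l ≡ h y → k ≢ l → x ≢ y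
      index≢ ek el k≢l x≡y = d≢ k≢l (trans ek (trans (cong h x≡y) (sym el)))
      d₃~w : d 3F ~ w
      d₃~w = subst (_~ w) (sym e₃) (adj-sym G w~t)
      d₃≢v₅ : d 3F ≢ v₅
      d₃≢v₅ e = v₅-off t (trans (sym e) e₃)
      ¬v₅~d₃ : ¬ v₅ ~ d 3F
      ¬v₅~d₃ a = pendant-nonadjacent j₂≢t (subst₂ _~_ e₃ e₂ (adj-sym G (d-adj 2F))) (subst (v₅ ~_) e₃ a)
      hole-apart-w : ∀ {k j} → d k ≡ h j → j ≢ t → d k ≢ w × ¬ d k ~ w
      hole-apart-w e j≢t = (λ e' → far-edge j≢t (subst (_~ v₅) (trans (sym e') e) (adj-sym G v₅~w))) ,
        λ a → far-path j≢t (subst (_~ w) e a) (adj-sym G v₅~w)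
      hole-apart-v₅ : ∀ {k j} → d k ≡ h j → j ≢ t → d k ≢ v₅ × ¬ d k ~ v₅
      hole-apart-v₅ e j≢t = (λ e' → v₅-off _ (trans (sym e') e)) , λ a → far-edge j≢t (subst (_~ v₅) e a)
      -- the long diagonals d₀d₃, d₂d₅ would make three hole positions pairwise consecutive
      ¬d₀~d₃ : ¬ d 0F ~ d 3F
      ¬d₀~d₃ a = no-triangle j₀≢t
        (path⇒consecutive {z = d 1F} (index≢ e₀ e₂ (λ ())) (subst (_~ _) e₀ (d-adj 0F)) (subst (_ ~_) e₂ (d-adj 1F)))
        (edge⇒consecutive (subst₂ _~_ e₂ e₃ (d-adj 2F))) (edge⇒consecutive (subst₂ _~_ e₃ e₀ (adj-sym G a)))
      ¬d₂~d₅ : ¬ d 2F ~ d 5F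
      ¬d₂~d₅ a = no-triangle (index≢ e₂ e₅ (λ ()))
        (edge⇒consecutive (subst₂ _~_ e₂ e₃ (d-adj 2F)))
        (path⇒consecutive {z = d 4F} (λ e → j₅≢t (sym e)) (subst (_~ _) e₃ (d-adj 3F)) (subst (_ ~_) e₅ (d-adj 4F)))
        (edge⇒consecutive (subst₂ _~_ e₅ e₂ (adj-sym G a)))
      d₁≢v₅ : d 1F ≢ v₅
      d₁≢v₅ e = far-edge j₀≢t (subst₂ _~_ e₀ e (d-adj 0F))
      d₄≢v₅ : d 4F ≢ v₅
      d₄≢v₅ e = ¬v₅~d₃ (subst (_~ d 3F) e (adj-sym G (d-adj 3F)))
      d₁≢w : d 1F ≢ w
      d₁≢w e = two-apart (d-adj 1F) (d-adj 2F) (subst (_~ d 3F) (sym e) (adj-sym G d₃~w))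
      d₄≢w : d 4F ≢ w
      d₄≢w e = no-four-neighbours G deg (d 3F) (d 5F) (d 1F) v₅
        (d≢ (λ ())) (d≢ (λ ())) d₃≢v₅ (d≢ (λ ())) (proj₁ (hole-apart-v₅ e₅ j₅≢t)) d₁≢v₅
        (adj-sym G (d-adj 3F)) (d-adj 4F) (adj-sym G chord) (subst (_~ v₅) (sym e) (adj-sym G v₅~w))
      ¬d₁~w : ¬ d 1F ~ w
      ¬d₁~w a = no-four-neighbours G deg (d 0F) (d 2F) (d 4F) w
        (d≢ (λ ())) (d≢ (λ ())) (proj₁ (hole-apart-w e₀ j₀≢t)) (d≢ (λ ())) (proj₁ (hole-apart-w e₂ j₂≢t)) d₄≢w
        (adj-sym G (d-adj 0F)) (d-adj 1F) chord a
      ¬d₄~w : ¬ d 4F ~ w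
      ¬d₄~w a = no-four-neighbours G deg (d 3F) (d 5F) (d 1F) w
        (d≢ (λ ())) (d≢ (λ ())) (λ e → irrefl G (subst (_~ w) e d₃~w)) (d≢ (λ ())) (proj₁ (hole-apart-w e₅ j₅≢t)) d₁≢w
        (adj-sym G (d-adj 3F)) (d-adj 4F) (adj-sym G chord) a
      ¬d₁~v₅ : ¬ d 1F ~ v₅
      ¬d₁~v₅ a = no-four-neighbours G deg (d 0F) (d 2F) (d 4F) v₅
        (d≢ (λ ())) (d≢ (λ ())) (proj₁ (hole-apart-v₅ e₀ j₀≢t)) (d≢ (λ ())) (proj₁ (hole-apart-v₅ e₂ j₂≢t)) d₄≢v₅
        (adj-sym G (d-adj 0F)) (d-adj 1F) chord a
      ¬d₄~v₅ : ¬ d 4F ~ v₅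
      ¬d₄~v₅ a = no-four-neighbours G deg (d 3F) (d 5F) (d 1F) v₅
        (d≢ (λ ())) (d≢ (λ ())) d₃≢v₅ (d≢ (λ ())) (proj₁ (hole-apart-v₅ e₅ j₅≢t)) d₁≢v₅
        (adj-sym G (d-adj 3F)) (d-adj 4F) (adj-sym G chord) a

    domino-in-position : ∀ (c : Fin 6 → V) → IsCycle 6 c → (σ : Fin 6 → Fin 6) → True (hexagon-symmetry? σ) →
      c (σ 1F) ~ c (σ 4F) → HoleAt c (σ 0F) → HoleAt c (σ 2F) → c (σ 3F) ≡ h t → HoleAt c (σ 5F) → InducedIn H₄ G
    domino-in-position c cyc σ ok = domino⇒H₄ (λ k → c (σ k)) (relabel c σ cyc (injective-from-pairs σ (proj₁ symmetry)) (proj₂ symmetry))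
      where
      symmetry : HexagonSymmetry σ
      symmetry = toWitness ok

    -- Every position is among any four distinct ones (true for holes of length 4).
    FourCover : Set
    FourCover = ∀ a b c d → a ≢ b → a ≢ c → a ≢ d → b ≢ c → b ≢ d → c ≢ d → t ≡ a ⊎ t ≡ b ⊎ t ≡ c ⊎ t ≡ d

    -- When the hole has length 4, h t is one of the four hole vertices c₁, c₂, c₄, c₅ of a
    -- domino of the lift; a reflection or rotation moves it to position 3 and yields an H₄.
    domino⇒pendant-H₄ : FourCover → Domino → InducedIn H₄ G
    domino⇒pendant-H₄ cover (c , cyc@(c-inj , _) , chord , on) with domino-hole-vertices c cyc chord on
    ... | (i₁ , e₁) , (i₂ , e₂) , (i₄ , e₄) , (i₅ , e₅)
        with cover i₁ i₂ i₄ i₅ (apart e₁ e₂ (λ ())) (apart e₁ e₄ (λ ())) (apart e₁ e₅ (λ ()))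
                               (apart e₂ e₄ (λ ())) (apart e₂ e₅ (λ ())) (apart e₄ e₅ (λ ()))
      where
      apart : ∀ {k l x y} → c k ≡ h x → c l ≡ h y → k ≢ l → x ≢ y
      apart ek el k≢l x≡y = k≢l (c-inj (trans ek (trans (cong h x≡y) (sym el))))
    ... | inj₁ refl = domino-in-position c cyc (Vec.lookup (4F ∷ 3F ∷ 2F ∷ 1F ∷ 0F ∷ 5F ∷ [])) tt
                        (adj-sym G chord) (i₄ , e₄) (i₂ , e₂) e₁ (i₅ , e₅)
    ... | inj₂ (inj₁ refl) = domino-in-position c cyc (Vec.lookup (5F ∷ 0F ∷ 1F ∷ 2F ∷ 3F ∷ 4F ∷ [])) tt
                        chord (i₅ , e₅) (i₁ , e₁) e₂ (i₄ , e₄)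
    ... | inj₂ (inj₂ (inj₁ refl)) = domino-in-position c cyc (Vec.lookup (1F ∷ 0F ∷ 5F ∷ 4F ∷ 3F ∷ 2F ∷ [])) tt
                        chord (i₁ , e₁) (i₅ , e₅) e₄ (i₂ , e₂)
    ... | inj₂ (inj₂ (inj₂ refl)) = domino-in-position c cyc (Vec.lookup (2F ∷ 3F ∷ 4F ∷ 5F ∷ 0F ∷ 1F ∷ [])) tt
                        (adj-sym G chord) (i₂ , e₂) (i₄ , e₄) e₅ (i₁ , e₁)

no-long-even-hole : ∀ (G : Graph) → ChordalBipartite G → ¬ Cycles.LongEvenHole G
no-long-even-hole G (_ , no-cycle) (L , c , cyc , chordless , 6≤L , even) with even⇒double L even
... | k , refl = no-cycle k 3≤k (Cycles.chordless-cycle⇒induced G (2 ℕ.* k) (≤-trans 3≤k (m≤n*m k 2)) c cyc chordless)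
  where
  3≤k : 3 ≤ k
  3≤k = ≰⇒> (λ k≤2 → 6≰4 (≤-trans 6≤L (*-monoʳ-≤ 2 k≤2)))
    where
    6≰4 : ¬ (6 ≤ 4)
    6≰4 (s≤s (s≤s (s≤s (s≤s ()))))

-- Part (i): G² has no hole.  The lift of a hole of G² reduces to a long even hole of G,
-- impossible as G is chordal bipartite, or to a domino, impossible for holes of length ≥ 5.
square-hole-free : ∀ (G : Graph) → DecidableGraph G → ChordalBipartite G → MaxDegree≤3 G → HoleFree (square G)
square-hole-free G dec cb deg m 5≤m hole =
  Data.Sum.[ no-long-even-hole G cb , Lift.no-domino G dec col proper deg m 4≤m h cyc chordless 5≤m ]′
    (Lift.lift-reduces G dec col proper deg m 4≤m h cyc chordless)
  where
  col : Fin (n G) → Bool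
  col = proj₁ (proj₁ cb)
  proper : ∀ {x y} → Adj G x y → col x ≢ col y
  proper = proj₂ (proj₁ cb)
  4≤m : 4 ≤ m
  4≤m = ≤-trans (n≤1+n 4) 5≤m
  3≤m : 3 ≤ m
  3≤m = ≤-trans (n≤1+n 3) 4≤m
  h : Fin m → Fin (n G)
  h = proj₁ hole
  cyc : Cycles.IsCycle (square G) m h
  cyc = proj₁ (Cycles.induced⇒chordless-cycle (square G) m 3≤m (h , proj₂ hole))
  chordless : Cycles.Chordless (square G) m h
  chordless = proj₂ (Cycles.induced⇒chordless-cycle (square G) m 3≤m (h , proj₂ hole))

A₄-cycle : ∀ (i j : Fin 4) → (Adj A₄ (F.inject₁ i) (F.inject₁ j) → Consecutive i j) ×
                              (next i ≡ j → Adj A₄ (F.inject₁ i) (F.inject₁ j))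
A₄-cycle = toWitness {a? = all? λ i → all? λ j →
  (adj? _ _ →-dec consecutive? i j) ×-dec (next i ≟ᶠ j →-dec adj? _ _)} tt
  where
  adj? : DecidableGraph A₄
  adj? = fromEdges-decidable 5 _

A₄-pendant : Adj A₄ 4F 2F × (∀ (j : Fin 4) → j ≢ 2F → ¬ Adj A₄ 4F (F.inject₁ j)) × (∀ (j : Fin 4) → 4F ≢ F.inject₁ j)
A₄-pendant = toWitness {a? = adj? 4F 2F ×-dec (all? λ j → ¬? (j ≟ᶠ 2F) →-dec ¬? (adj? 4F (F.inject₁ j))) ×-dec
                             all? λ j → ¬? (4F ≟ᶠ F.inject₁ j)} tt
  where
  adj? : DecidableGraph A₄
  adj? = fromEdges-decidable 5 _

four-cover : ∀ (t a b c d : Fin 4) → a ≢ b → a ≢ c → a ≢ d → b ≢ c → b ≢ d → c ≢ d →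
  t ≡ a ⊎ t ≡ b ⊎ t ≡ c ⊎ t ≡ d
four-cover = toWitness {a? = all? λ t → all? λ a → all? λ b → all? λ c → all? λ d →
  ¬? (a ≟ᶠ b) →-dec ¬? (a ≟ᶠ c) →-dec ¬? (a ≟ᶠ d) →-dec ¬? (b ≟ᶠ c) →-dec ¬? (b ≟ᶠ d) →-dec ¬? (c ≟ᶠ d) →-dec
  (t ≟ᶠ a ⊎-dec t ≟ᶠ b ⊎-dec t ≟ᶠ c ⊎-dec t ≟ᶠ d)} tt

-- The 4-cycle of an induced A₄ of G² is a hole of
-- length 4 whose lift reduces to a long even hole, impossible, or to a domino, which the
-- pendant vertex of A₄ extends to an induced H₄ of G.
square-A₄-free : ∀ (G : Graph) → DecidableGraph G → ChordalBipartite G → MaxDegree≤3 G → (H₄ -free) G → (A₄ -free) (square G)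
square-A₄-free G dec cb deg H₄-free (f , f-inj , f-adj) =
  Data.Sum.[ no-long-even-hole G cb , (λ domino → H₄-free (domino⇒pendant-H₄ (four-cover 2F) domino)) ]′ lift-reduces
  where
  col : Fin (n G) → Bool
  col = proj₁ (proj₁ cb)
  proper : ∀ {x y} → Adj G x y → col x ≢ col y
  proper = proj₂ (proj₁ cb)
  h : Fin 4 → Fin (n G)
  h k = f (F.inject₁ k)
  cyc : Cycles.IsCycle (square G) 4 h
  cyc = (λ e → inject₁-injective (f-inj e)) , λ k → proj₂ (f-adj _ _) (proj₂ (A₄-cycle k (next k)) refl)
  chordless : Cycles.Chordless (square G) 4 h
  chordless i j a = proj₁ (A₄-cycle i j) (proj₁ (f-adj _ _) a)
  v₅~²t : Adj (square G) (f 4F) (h 2F)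
  v₅~²t = proj₂ (f-adj 4F 2F) (proj₁ A₄-pendant)
  v₅-far : ∀ j → j ≢ 2F → ¬ Adj (square G) (f 4F) (h j)
  v₅-far j j≢2 a = proj₁ (proj₂ A₄-pendant) j j≢2 (proj₁ (f-adj 4F _) a)
  v₅-off : ∀ j → f 4F ≢ h j
  v₅-off j e = proj₂ (proj₂ A₄-pendant) j (f-inj e)
  open Lift G dec col proper deg 4 ≤-refl h cyc chordless using (lift-reduces)
  open Lift.Pendant G dec col proper deg 4 ≤-refl h cyc chordless 2F (f 4F) v₅~²t v₅-far v₅-off using (domino⇒pendant-H₄)

theorem12 : (G : Graph) → DecidableGraph G → ChordalBipartite G → MaxDegree≤3 G →
    HoleFree (square G) × ((H₄ -free) G → (A₄ -free) (square G))
theorem12 G dec cb deg = square-hole-free G dec cb deg , square-A₄-free G dec cb deg
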